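{- Let $G$ be a graph, let $A, B \subseteq V(G)$ be (not necessarily disjoint) vertex subsets, and let $(T,\delta)$ be any branch decomposition of $G$. Then there exists a cut $(X,Y)$ of $G$ induced by an edge of $T$ such that $|X \cap A| \geq \lfloor |A|/3 \rfloor$ and $|Y \cap B| \geq \lfloor |B|/3 \rfloor$.
   Context: A branch decomposition $(T,\delta)$ of a graph $G$ consists of a tree $T$ of maximum degree $3$ and a bijection $\delta$ from the leaves of $T$ to $V(G)$. Each edge $e$ of $T$ induces the cut $(X, V(G)\setminus X)$ where $X$ is the set of vertices $\delta(\ell)$ for leaves $\ell$ of one of the two components of $T - e$ (either orientation of the cut is allowed). -}

module Defs where

open import Data.Nat using (ℕ; zero; suc; _≤_; _+_)
open import Data.Nat.DivMod using (_/_)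
open import Data.Bool using (Bool; true; false; _∧_; _∨_; not)
open import Data.Fin using (Fin; zero; suc; inject₁; fromℕ; _≟_)
open import Data.Fin.Subset using (Subset; _∈_; _∉_; ∣_∣)
open import Data.Vec using (tabulate)
open import Data.Product using (Σ; Σ-syntax; _×_; ∃-syntax; _,_)
open import Function.Definitions using (Injective)
open import Function.Bundles using (_⤖_; Bijection)
open import Relation.Binary.PropositionalEquality using (_≡_)
open import Relation.Nullary using (¬_)
open import Relation.Nullary.Decidable using (⌊_⌋)

record Graph (n : ℕ) : Set where
  field
    adj   : Fin n → Fin n → Bool
    sym   : ∀ u v → adj u v ≡ adj v u
    irrefl : ∀ v → adj v v ≡ false
open Graph public

degree : ∀ {m} → Graph m → Fin m → ℕ
degree T v = ∣ tabulate (adj T v) ∣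

data Reach {m : ℕ} (a : Fin m → Fin m → Bool) : Fin m → Fin m → Set where
  here : ∀ {u} → Reach a u u
  step : ∀ {u w v} → a u w ≡ true → Reach a w v → Reach a u v

Connected : ∀ {m} → Graph m → Set
Connected T = ∀ u v → Reach (adj T) u v

HasCycle : ∀ {m} → Graph m → Set
HasCycle {m} T =
  Σ[ k ∈ ℕ ] Σ[ f ∈ (Fin (3 + k) → Fin m) ]
    Injective _≡_ _≡_ f
    × (∀ (i : Fin (2 + k)) → adj T (f (inject₁ i)) (f (suc i)) ≡ true)
    × adj T (f (fromℕ (2 + k))) (f zero) ≡ true

IsTree : ∀ {m} → Graph m → Set
IsTree T = Connected T × ¬ HasCycle T

MaxDegree≤3 : ∀ {m} → Graph m → Set
MaxDegree≤3 T = ∀ v → degree T v ≤ 3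

Leaf : ∀ {m} → Graph m → Set
Leaf {m} T = Σ[ t ∈ Fin m ] degree T t ≡ 1

record BranchDecomposition {n : ℕ} (G : Graph n) : Set where
  field
    m      : ℕ
    T      : Graph m
    tree   : IsTree T
    maxdeg : MaxDegree≤3 T
    δ      : Leaf T ⤖ Fin n
open BranchDecomposition public

adjWithout : ∀ {m} → Graph m → Fin m → Fin m → Fin m → Fin m → Bool
adjWithout T a b u w =
  adj T u w ∧ not ((⌊ u ≟ a ⌋ ∧ ⌊ w ≟ b ⌋) ∨ (⌊ u ≟ b ⌋ ∧ ⌊ w ≟ a ⌋))

-- The side X of the cut induced by the edge e = {a,b} of T containing a:
-- x ∈ X iff the leaf δ⁻¹(x) lies in the component of T - e containing a.
CutSide : ∀ {n} {G : Graph n} (D : BranchDecomposition G) →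
          Fin (m D) → Fin (m D) → Fin n → Set
CutSide D a b x =
  Σ[ ℓ ∈ Leaf (T D) ] (Bijection.to (δ D) ℓ ≡ x
                       × Reach (adjWithout (T D) a b) a (Data.Product.proj₁ ℓ))

-- |S| ≥ k for a (not necessarily decidable) predicate S on Fin n:
-- there are k distinct elements satisfying S.
AtLeast : ∀ {n} → ℕ → (Fin n → Set) → Set
AtLeast {n} k S = Σ[ f ∈ (Fin k → Fin n) ] Injective _≡_ _≡_ f × (∀ i → S (f i))

module Submission where

-- We first find an edge ab
-- that is BALANCED for A: both sides carry at least ⌊|A|/3⌋ elements of A.
-- Starting from any edge oriented towards its heavier side, walk into the
-- heavy side: if the far side is light, the near side holds more than
-- 2⌊|A|/3⌋ elements; this side splits into a possible leaf at a (at most one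
-- element) and the sides hanging off the (at most two) other neighbours of
-- a, so some neighbour c must carry more than ⌊|A|/3⌋ and we move to the
-- edge ca, whose side is strictly smaller.  Then, whatever B is, one side of
-- the balanced edge contains at least ⌊|B|/3⌋ elements of B; orient the edge
-- so that it is the complementary side Y.

open import Defs hiding (sym)
open import Data.Nat using (ℕ; zero; suc; _≤_; _<_; _+_; _*_; _∸_; z≤n; s≤s)
import Data.Nat.Properties as ℕP
open import Algebra.Properties.CommutativeSemigroup ℕP.+-commutativeSemigroup
  using (interchange)
open import Data.Nat.DivMod using (_/_; m/n*n≤m)
open import Data.Fin using (Fin; zero; suc; inject₁; fromℕ; inject≤; _≟_)
import Data.Fin.Properties as FinP
open import Data.Fin.Subset using (Subset; _∈_; ∣_∣)
open import Data.Bool using (Bool; true; false; _∧_; _∨_; not; if_then_else_)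
import Data.Bool.Properties as BoolP
open import Data.Vec using ([]; _∷_; tabulate; lookup)
open import Data.Vec.Properties using (lookup⇒[]=)
open import Data.Product using (Σ-syntax; ∃; ∃₂; _×_; _,_; proj₁; proj₂)
open import Data.Sum using (_⊎_; inj₁; inj₂)
open import Data.Empty using (⊥; ⊥-elim)
open import Function.Definitions using (Injective)
open import Function.Bundles using (Bijection)
open import Relation.Binary.PropositionalEquality
open import Relation.Nullary using (¬_; yes; no)
open import Relation.Nullary.Decidable using (⌊_⌋; _×-dec_)

true≢false : ∀ {b} → b ≡ true → b ≡ false → ⊥
true≢false refl ()

∧-left : ∀ {x y} → x ∧ y ≡ true → x ≡ true
∧-left = BoolP.∧-conicalˡ _ _

∧-right : ∀ {x y} → x ∧ y ≡ true → y ≡ true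
∧-right = BoolP.∧-conicalʳ _ _

∧-intro : ∀ {x y} → x ≡ true → y ≡ true → x ∧ y ≡ true
∧-intro refl refl = refl

≟-refl : ∀ {n} (x : Fin n) → ⌊ x ≟ x ⌋ ≡ true
≟-refl x with x ≟ x
... | yes _ = refl
... | no x≢x = ⊥-elim (x≢x refl)

≟-sound : ∀ {n} {x y : Fin n} → ⌊ x ≟ y ⌋ ≡ true → x ≡ y
≟-sound {x = x} {y} e with x ≟ y
... | yes x≡y = x≡y

ι : Bool → ℕ
ι b = if b then 1 else 0

count : ∀ {n} → (Fin n → Bool) → ℕ
count {zero}  f = 0
count {suc n} f = ι (f zero) + count (λ x → f (suc x))

_⊑_ : ∀ {n} → (Fin n → Bool) → (Fin n → Bool) → Set
f ⊑ g = ∀ x → f x ≡ true → g x ≡ true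

ι-mono : ∀ {a b} → (a ≡ true → b ≡ true) → ι a ≤ ι b
ι-mono {false}         _ = z≤n
ι-mono {true}  {true}  _ = s≤s z≤n
ι-mono {true}  {false} h = ⊥-elim (true≢false (h refl) refl)

count-mono : ∀ {n} {f g : Fin n → Bool} → f ⊑ g → count f ≤ count g
count-mono {zero}  f⊑g = z≤n
count-mono {suc n} f⊑g =
  ℕP.+-mono-≤ (ι-mono (f⊑g zero)) (count-mono (λ x → f⊑g (suc x)))

count-pos : ∀ {n} (f : Fin n → Bool) x → f x ≡ true → 0 < count f
count-pos f zero    fx rewrite fx = s≤s z≤n
count-pos f (suc x) fx = ℕP.<-≤-trans (count-pos (λ y → f (suc y)) x fx) (ℕP.m≤n+m _ (ι (f zero)))

count-< : ∀ {n} {f g : Fin n → Bool} → f ⊑ g →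
          ∀ x → g x ≡ true → f x ≡ false → count f < count g
count-< {suc n} {f} {g} f⊑g zero gx fx rewrite gx | fx =
  s≤s (count-mono (λ x → f⊑g (suc x)))
count-< {suc n} f⊑g (suc x) gx fx =
  ℕP.+-mono-≤-< (ι-mono (f⊑g zero)) (count-< (λ y → f⊑g (suc y)) x gx fx)

count-≤ : ∀ {n} (f : Fin n → Bool) → count f ≤ n
count-≤ {zero}  f = z≤n
count-≤ {suc n} f = ℕP.+-mono-≤ (ι≤1 (f zero)) (count-≤ (λ x → f (suc x)))
  where
  ι≤1 : ∀ b → ι b ≤ 1
  ι≤1 true  = s≤s z≤n
  ι≤1 false = z≤n

count-none : ∀ {n} (f : Fin n → Bool) → (∀ x → ¬ f x ≡ true) → count f ≡ 0
count-none {zero}  f none = refl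
count-none {suc n} f none with f zero in e
... | true  = ⊥-elim (none zero e)
... | false = count-none (λ x → f (suc x)) (λ x → none (suc x))

count-witness : ∀ {n} (f : Fin n → Bool) → 0 < count f → ∃ λ x → f x ≡ true
count-witness {suc n} f pos with f zero in e
... | true  = zero , e
... | false = let x , fx = count-witness (λ x → f (suc x)) pos in suc x , fx

count-≤1 : ∀ {n} (f : Fin n → Bool) →
           (∀ x y → f x ≡ true → f y ≡ true → x ≡ y) → count f ≤ 1
count-≤1 {zero}  f unique = z≤n
count-≤1 {suc n} f unique with f zero in e
... | true  = ℕP.≤-reflexive (cong suc (count-none _ (λ x fx → 0≢suc (unique zero (suc x) e fx))))
  where
  0≢suc : ∀ {x : Fin n} → zero ≢ suc x
  0≢suc ()
... | false = count-≤1 (λ x → f (suc x))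
                       (λ x y fx fy → FinP.suc-injective (unique (suc x) (suc y) fx fy))

count-∪ : ∀ {n} (f g h : Fin n → Bool) →
          (∀ x → f x ≡ true → g x ≡ true ⊎ h x ≡ true) → count f ≤ count g + count h
count-∪ {zero}  f g h cover = z≤n
count-∪ {suc n} f g h cover = begin
  ι (f zero) + count (λ x → f (suc x))
    ≤⟨ ℕP.+-mono-≤ (ι-∪ (cover zero)) (count-∪ _ _ _ (λ x → cover (suc x))) ⟩
  (ι (g zero) + ι (h zero)) + (count (λ x → g (suc x)) + count (λ x → h (suc x)))
    ≡⟨ interchange (ι (g zero)) (ι (h zero)) _ _ ⟩
  (ι (g zero) + count (λ x → g (suc x))) + (ι (h zero) + count (λ x → h (suc x))) ∎
  where
  open ℕP.≤-Reasoning
  ι-∪ : ∀ {a b c} → (a ≡ true → b ≡ true ⊎ c ≡ true) → ι a ≤ ι b + ι c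
  ι-∪ {false}                 _ = z≤n
  ι-∪ {true}  {true}          _ = s≤s z≤n
  ι-∪ {true}  {false} {true}  _ = s≤s z≤n
  ι-∪ {true}  {false} {false} h with h refl
  ... | inj₁ ()
  ... | inj₂ ()

count-⋃ : ∀ {m n} (N : Fin m → Bool) (F : Fin m → Fin n → Bool) (f : Fin n → Bool) k →
          (∀ c → N c ≡ true → count (F c) ≤ k) →
          (∀ x → f x ≡ true → ∃ λ c → N c ≡ true × F c x ≡ true) →
          count f ≤ count N * k
count-⋃ {zero} N F f k small cover =
  ℕP.≤-reflexive (count-none f (λ x fx → FinP.¬Fin0 (proj₁ (cover x fx))))
count-⋃ {suc m} N F f k small cover with N zero in N₀
... | false = count-⋃ (λ c → N (suc c)) (λ c → F (suc c)) f k (λ c → small (suc c)) cover⁺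
  where
  cover⁺ : ∀ x → f x ≡ true → ∃ λ c → N (suc c) ≡ true × F (suc c) x ≡ true
  cover⁺ x fx with cover x fx
  ... | zero  , Nc , _  = ⊥-elim (true≢false Nc N₀)
  ... | suc c , Nc , Fx = c , Nc , Fx
... | true = ℕP.≤-trans (count-∪ f (F zero) rest split)
                        (ℕP.+-mono-≤ (small zero N₀) restBound)
  where
  rest : _ → Bool
  rest x = f x ∧ not (F zero x)
  split : ∀ x → f x ≡ true → F zero x ≡ true ⊎ rest x ≡ true
  split x fx with F zero x
  ... | true  = inj₁ refl
  ... | false = inj₂ (∧-intro fx refl)
  restBound : count rest ≤ count (λ c → N (suc c)) * k
  restBound = count-⋃ (λ c → N (suc c)) (λ c → F (suc c)) rest k (λ c → small (suc c)) cover⁺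
    where
    cover⁺ : ∀ x → rest x ≡ true → ∃ λ c → N (suc c) ≡ true × F (suc c) x ≡ true
    cover⁺ x rx with cover x (∧-left rx)
    ... | zero  , _  , Fx = ⊥-elim (true≢false Fx (BoolP.not-injective (∧-right rx)))
    ... | suc c , Nc , Fx = c , Nc , Fx

atLeast-count : ∀ {n} k (S : Fin n → Set) (f : Fin n → Bool) →
                (∀ x → f x ≡ true → S x) → k ≤ count f → AtLeast k S
atLeast-count k S f sound k≤ =
  let g , g-inj , g-ok = enumerate f in
  (λ i → g (inject≤ i k≤)) ,
  (λ {i} {j} eq → FinP.inject≤-injective k≤ k≤ i j (g-inj eq)) ,
  (λ i → sound _ (g-ok (inject≤ i k≤)))
  where
  enumerate : ∀ {n} (f : Fin n → Bool) →
              Σ[ g ∈ (Fin (count f) → Fin n) ] Injective _≡_ _≡_ g × (∀ i → f (g i) ≡ true)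
  enumerate {zero}  f = (λ ()) , (λ {i} → ⊥-elim (FinP.¬Fin0 i)) , (λ ())
  enumerate {suc n} f with f zero in f₀ | enumerate (λ x → f (suc x))
  ... | false | g , g-inj , g-ok = (λ i → suc (g i)) , (λ eq → g-inj (FinP.suc-injective eq)) , g-ok
  ... | true  | g , g-inj , g-ok = g′ , (λ {i} {j} → g′-inj i j) , g′-ok
    where
    g′ : Fin (suc (count (λ x → f (suc x)))) → Fin (suc n)
    g′ zero    = zero
    g′ (suc i) = suc (g i)
    g′-inj : ∀ i j → g′ i ≡ g′ j → i ≡ j
    g′-inj zero    zero    _  = refl
    g′-inj (suc i) (suc j) eq = cong suc (g-inj (FinP.suc-injective eq))
    g′-ok : ∀ i → f (g′ i) ≡ true
    g′-ok zero    = f₀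
    g′-ok (suc i) = g-ok i

count-tabulate : ∀ {n} (f : Fin n → Bool) → count f ≡ ∣ tabulate f ∣
count-tabulate {zero}  f = refl
count-tabulate {suc n} f with f zero
... | true  = cong suc (count-tabulate (λ x → f (suc x)))
... | false = count-tabulate (λ x → f (suc x))

count-lookup : ∀ {n} (A : Subset n) → count (lookup A) ≡ ∣ A ∣
count-lookup []          = refl
count-lookup (true ∷ A)  = cong suc (count-lookup A)
count-lookup (false ∷ A) = count-lookup A

module Walks {m : ℕ} (r : Fin m → Fin m → Bool) where

  snoc : ∀ {u v w} → Reach r u v → r v w ≡ true → Reach r u w
  snoc here         e = step e here
  snoc (step e′ ρ) e = step e′ (snoc ρ e)

  _++_ : ∀ {u v w} → Reach r u v → Reach r v w → Reach r u w
  here     ++ σ = σ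
  step e ρ ++ σ = step e (ρ ++ σ)

  reverse : (∀ x y → r x y ≡ r y x) → ∀ {u v} → Reach r u v → Reach r v u
  reverse r-sym here               = here
  reverse r-sym (step {u} {w} e ρ) = snoc (reverse r-sym ρ) (trans (r-sym w u) e)

  transport : (P : Fin m → Set) → (∀ x y → P x → r x y ≡ true → P y) →
              ∀ {u v} → P u → Reach r u v → P v
  transport P P-step Pu here       = Pu
  transport P P-step Pu (step e ρ) = transport P P-step (P-step _ _ Pu e) ρ

  data Path : Fin m → Fin m → Set
  length : ∀ {u v} → Path u v → ℕ
  vertex : ∀ {u v} (p : Path u v) → Fin (suc (length p)) → Fin m

  data Path where
    nil  : ∀ {v} → Path v v
    cons : ∀ {u w v} → r u w ≡ true → (p : Path w v) → (∀ i → vertex p i ≢ u) → Path u v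

  length nil          = 0
  length (cons _ p _) = suc (length p)

  vertex {u} nil          zero    = u
  vertex {u} (cons _ _ _) zero    = u
  vertex     (cons _ p _) (suc i) = vertex p i

  vertex-first : ∀ {u v} (p : Path u v) → vertex p zero ≡ u
  vertex-first nil          = refl
  vertex-first (cons _ _ _) = refl

  vertex-last : ∀ {u v} (p : Path u v) → vertex p (fromℕ (length p)) ≡ v
  vertex-last nil          = refl
  vertex-last (cons _ p _) = vertex-last p

  vertex-injective : ∀ {u v} (p : Path u v) → Injective _≡_ _≡_ (vertex p)
  vertex-injective nil            {zero}  {zero}  _  = refl
  vertex-injective (cons _ p new) {zero}  {zero}  _  = refl
  vertex-injective (cons _ p new) {zero}  {suc j} eq = ⊥-elim (new j (sym eq))
  vertex-injective (cons _ p new) {suc i} {zero}  eq = ⊥-elim (new i eq)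
  vertex-injective (cons _ p new) {suc i} {suc j} eq = cong suc (vertex-injective p eq)

  vertex-adjacent : ∀ {u v} (p : Path u v) (i : Fin (length p)) →
                    r (vertex p (inject₁ i)) (vertex p (suc i)) ≡ true
  vertex-adjacent (cons {u} e p _) zero    = subst (λ z → r u z ≡ true) (sym (vertex-first p)) e
  vertex-adjacent (cons _ p _)     (suc i) = vertex-adjacent p i

  -- A path visits distinct vertices, so it has fewer than m edges.
  length-< : ∀ {u v} (p : Path u v) → length p < m
  length-< p = FinP.injective⇒≤ (vertex-injective p)

  suffix : ∀ {u w v} (p : Path w v) (i : Fin (suc (length p))) → vertex p i ≡ u → Path u v
  suffix {v = v} p zero eq = subst (λ z → Path z v) (trans (sym (vertex-first p)) eq) p
  suffix (cons _ p _) (suc i) eq = suffix p i eq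

  -- Every walk can be shortened to a simple path: cut out the cycle
  -- whenever a new vertex is already on the path.
  toPath : ∀ {u v} → Reach r u v → Path u v
  toPath here = nil
  toPath (step {u} e ρ) with toPath ρ
  ... | p with FinP.any? (λ i → vertex p i ≟ u)
  ...   | yes (i , eq) = suffix p i eq
  ...   | no  new      = cons e p (λ i eq → new (i , eq))

  any : ∀ {k} → (Fin k → Bool) → Bool
  any {zero}  f = false
  any {suc k} f = f zero ∨ any (λ x → f (suc x))

  any-intro : ∀ {k} (f : Fin k → Bool) x → f x ≡ true → any f ≡ true
  any-intro f zero    fx rewrite fx = refl
  any-intro f (suc x) fx rewrite any-intro (λ y → f (suc y)) x fx = BoolP.∨-zeroʳ (f zero)

  any-elim : ∀ {k} (f : Fin k → Bool) → any f ≡ true → ∃ λ x → f x ≡ true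
  any-elim {suc k} f e with f zero in f₀
  ... | true  = zero , f₀
  ... | false = let x , fx = any-elim (λ y → f (suc y)) e in suc x , fx

  reachableWithin : ℕ → Fin m → Fin m → Bool
  reachableWithin zero    u v = ⌊ u ≟ v ⌋
  reachableWithin (suc k) u v =
    reachableWithin k u v ∨ any (λ w → r u w ∧ reachableWithin k w v)

  reachableWithin-sound : ∀ k u v → reachableWithin k u v ≡ true → Reach r u v
  reachableWithin-sound zero u v e rewrite ≟-sound {x = u} e = here
  reachableWithin-sound (suc k) u v e with reachableWithin k u v in short
  ... | true  = reachableWithin-sound k u v short
  ... | false = let w , ew = any-elim _ e in
                step (∧-left ew) (reachableWithin-sound k w v (∧-right ew))

  reachableWithin-weaken : ∀ j k u v → reachableWithin k u v ≡ true →
                           reachableWithin (j + k) u v ≡ true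
  reachableWithin-weaken zero    k u v e = e
  reachableWithin-weaken (suc j) k u v e rewrite reachableWithin-weaken j k u v e = refl

  path-within : ∀ {u v} (p : Path u v) → reachableWithin (length p) u v ≡ true
  path-within {u} nil = ≟-refl u
  path-within {u} {v} (cons {w = w} e p _) with reachableWithin (length p) u v
  ... | true  = refl
  ... | false = any-intro (λ x → r u x ∧ reachableWithin (length p) x v) w (∧-intro e (path-within p))

  -- Decidable reachability: since simple paths have fewer than m edges,
  -- m steps suffice.
  reachable : Fin m → Fin m → Bool
  reachable = reachableWithin m

  reachable-complete : ∀ {u v} → Reach r u v → reachable u v ≡ true
  reachable-complete {u} {v} ρ =
    subst (λ z → reachableWithin z u v ≡ true) (ℕP.m∸n+n≡m (ℕP.<⇒≤ (length-< p)))
          (reachableWithin-weaken (m ∸ length p) (length p) u v (path-within p))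
    where p = toPath ρ

  reachable-sound : ∀ {u v} → reachable u v ≡ true → Reach r u v
  reachable-sound = reachableWithin-sound m _ _

Reach-map : ∀ {m} {r r′ : Fin m → Fin m → Bool} → (∀ x y → r x y ≡ true → r′ x y ≡ true) →
            ∀ {u v} → Reach r u v → Reach r′ u v
Reach-map r⊆r′ here       = here
Reach-map r⊆r′ (step e ρ) = step (r⊆r′ _ _ e) (Reach-map r⊆r′ ρ)

module EdgeSides {m : ℕ} (T : Graph m) (acyclic : ¬ HasCycle T) where

  W : Fin m → Fin m → Fin m → Fin m → Bool
  W = adjWithout T

  W⇒adj : ∀ {a b u w} → W a b u w ≡ true → adj T u w ≡ true
  W⇒adj = ∧-left

  W-sym : ∀ a b u w → W a b u w ≡ W a b w u
  W-sym a b u w = cong₂ (λ e d → e ∧ not d) (Graph.sym T u w) (begin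
    (⌊ u ≟ a ⌋ ∧ ⌊ w ≟ b ⌋) ∨ (⌊ u ≟ b ⌋ ∧ ⌊ w ≟ a ⌋)
      ≡⟨ BoolP.∨-comm (⌊ u ≟ a ⌋ ∧ ⌊ w ≟ b ⌋) _ ⟩
    (⌊ u ≟ b ⌋ ∧ ⌊ w ≟ a ⌋) ∨ (⌊ u ≟ a ⌋ ∧ ⌊ w ≟ b ⌋)
      ≡⟨ cong₂ _∨_ (BoolP.∧-comm ⌊ u ≟ b ⌋ _) (BoolP.∧-comm ⌊ u ≟ a ⌋ _) ⟩
    (⌊ w ≟ a ⌋ ∧ ⌊ u ≟ b ⌋) ∨ (⌊ w ≟ b ⌋ ∧ ⌊ u ≟ a ⌋) ∎)
    where open ≡-Reasoning

  W-swap : ∀ a b u w → W a b u w ≡ W b a u w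
  W-swap a b u w = cong (λ d → adj T u w ∧ not d) (BoolP.∨-comm (⌊ u ≟ a ⌋ ∧ ⌊ w ≟ b ⌋) _)

  W-removed : ∀ a b → W a b a b ≡ false
  W-removed a b rewrite ≟-refl a | ≟-refl b = BoolP.∧-zeroʳ (adj T a b)

  not-both : ∀ {x y c d : Fin m} → ¬ (x ≡ c × y ≡ d) → ⌊ x ≟ c ⌋ ∧ ⌊ y ≟ d ⌋ ≡ false
  not-both {x} {y} {c} {d} ne with x ≟ c | y ≟ d
  ... | yes x≡c | yes y≡d = ⊥-elim (ne (x≡c , y≡d))
  ... | yes _   | no _    = refl
  ... | no _    | _       = refl

  W-kept : ∀ {a b u w} → adj T u w ≡ true →
           ¬ (u ≡ a × w ≡ b) → ¬ (u ≡ b × w ≡ a) → W a b u w ≡ true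
  W-kept e not-ab not-ba rewrite e | not-both not-ab | not-both not-ba = refl

  edge-or-kept : ∀ a b {u w} → adj T u w ≡ true →
                 (u ≡ a × w ≡ b) ⊎ (u ≡ b × w ≡ a) ⊎ W a b u w ≡ true
  edge-or-kept a b {u} {w} e with (u ≟ a) ×-dec (w ≟ b) | (u ≟ b) ×-dec (w ≟ a)
  ... | yes ab | _      = inj₁ ab
  ... | no _   | yes ba = inj₂ (inj₁ ba)
  ... | no ¬ab | no ¬ba = inj₂ (inj₂ (W-kept e ¬ab ¬ba))

  Side : Fin m → Fin m → Fin m → Bool
  Side a b = Walks.reachable (W a b) a

  side-sound : ∀ {a b x} → Side a b x ≡ true → Reach (W a b) a x
  side-sound {a} {b} = Walks.reachable-sound (W a b)

  side-complete : ∀ {a b x} → Reach (W a b) a x → Side a b x ≡ true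
  side-complete {a} {b} = Walks.reachable-complete (W a b)

  side-self : ∀ a b → Side a b a ≡ true
  side-self a b = side-complete here

  side-closed : ∀ {a b x y} → Side a b x ≡ true → W a b x y ≡ true → Side a b y ≡ true
  side-closed {a} {b} s e = side-complete (Walks.snoc (W a b) (side-sound s) e)

  -- Removing an edge ab of an acyclic graph separates b from a: a simple
  -- path from a to b avoiding ab would close a cycle with it.
  no-detour : ∀ {a b} → adj T a b ≡ true → ¬ Reach (W a b) a b
  no-detour {a} {b} e ρ = closes (toPath ρ)
    where
    open Walks (W a b)
    closes : Path a b → ⊥
    closes nil = true≢false e (irrefl T a)
    closes (cons e₁ nil _) = true≢false e₁ (W-removed a b)
    closes p@(cons _ (cons _ q _) _) = acyclic
      ( length q , vertex p , vertex-injective p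
      , (λ i → W⇒adj (vertex-adjacent p i))
      , subst (λ z → adj T z a ≡ true) (sym (vertex-last p)) (trans (Graph.sym T b a) e))

  sides-disjoint : ∀ {a b x} → adj T a b ≡ true → Side a b x ≡ true → Side b a x ≡ true → ⊥
  sides-disjoint {a} {b} e s₁ s₂ = no-detour e (side-sound s₁ ++ reverse (W-sym a b) back)
    where
    open Walks (W a b)
    back : Reach (W a b) b _
    back = Reach-map (λ u w q → trans (W-swap a b u w) q) (side-sound s₂)

  sides-cover : Connected T → ∀ a b x → Side a b x ≡ true ⊎ Side b a x ≡ true
  sides-cover connected a b x =
    Walks.transport (adj T) OnASide extend (inj₁ (side-self a b)) (connected a x)
    where
    OnASide : Fin m → Set
    OnASide y = Side a b y ≡ true ⊎ Side b a y ≡ true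
    extend : ∀ y z → OnASide y → adj T y z ≡ true → OnASide z
    extend y z sy e with edge-or-kept a b e | sy
    ... | inj₁ (_ , refl)        | _       = inj₂ (side-self b a)
    ... | inj₂ (inj₁ (_ , refl)) | _       = inj₁ (side-self a b)
    ... | inj₂ (inj₂ w)          | inj₁ s = inj₁ (side-closed s w)
    ... | inj₂ (inj₂ w)          | inj₂ s = inj₂ (side-closed s (trans (sym (W-swap a b y z)) w))

  OtherNbr : Fin m → Fin m → Fin m → Bool
  OtherNbr a b c = adj T a c ∧ not ⌊ c ≟ b ⌋

  otherNbr-adj : ∀ {a b c} → OtherNbr a b c ≡ true → adj T a c ≡ true
  otherNbr-adj = ∧-left

  otherNbr-≢ : ∀ {a b c} → OtherNbr a b c ≡ true → c ≢ b
  otherNbr-≢ {a} {c = c} nb refl rewrite ≟-refl c = true≢false nb (BoolP.∧-zeroʳ (adj T a c))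

  root-outside : ∀ {a b c} → OtherNbr a b c ≡ true → Side c a a ≡ false
  root-outside {a} {c = c} nb = BoolP.¬-not (λ s →
    sides-disjoint (trans (Graph.sym T c a) (otherNbr-adj nb)) s (side-self a c))

  adj-≢ : ∀ {u w} → adj T u w ≡ true → u ≢ w
  adj-≢ {u} e refl = true≢false e (irrefl T u)

  -- For another neighbour c of a, the side of ca at c lies inside the side
  -- of ab at a: walks in it avoid both a and b, hence never use ab.
  side-nested : ∀ {a b c} → adj T a b ≡ true → OtherNbr a b c ≡ true → Side c a ⊑ Side a b
  side-nested {a} {b} {c} ab nb x s =
    side-complete (step ac (inside (side-self c a) (side-sound s)))
    where
    ca : adj T c a ≡ true
    ca = trans (Graph.sym T c a) (otherNbr-adj nb)
    ac : W a b a c ≡ true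
    ac = W-kept (otherNbr-adj nb) (λ (_ , c≡b) → otherNbr-≢ nb c≡b) (λ (a≡b , _) → adj-≢ ab a≡b)
    a-outside : ∀ {y} → Side c a y ≡ true → y ≢ a
    a-outside sy refl = true≢false sy (root-outside nb)
    b-outside : ∀ {y} → Side c a y ≡ true → y ≢ b
    b-outside sy refl = sides-disjoint ca sy (side-closed (side-self a c) ab-kept)
      where
      ab-kept : W a c a b ≡ true
      ab-kept = W-kept ab (λ (_ , b≡c) → otherNbr-≢ nb (sym b≡c)) (λ (a≡c , _) → adj-≢ ca (sym a≡c))
    inside : ∀ {y z} → Side c a y ≡ true → Reach (W c a) y z → Reach (W a b) y z
    inside sy here = here
    inside sy (step e ρ) =
      step (W-kept (W⇒adj e) (λ (y≡a , _) → a-outside sy y≡a) (λ (y≡b , _) → b-outside sy y≡b))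
           (inside (side-closed sy e) ρ)

  side-shrinks : ∀ {a b c} → adj T a b ≡ true → OtherNbr a b c ≡ true →
                 count (Side c a) < count (Side a b)
  side-shrinks {a} {b} ab nb = count-< (side-nested ab nb) a (side-self a b) (root-outside nb)

  side-split : ∀ {a b x} → Side a b x ≡ true →
               x ≡ a ⊎ ∃ λ c → OtherNbr a b c ≡ true × Side c a x ≡ true
  side-split {a} {b} s = Walks.transport (W a b) Split extend (inj₁ refl) (side-sound s)
    where
    Split : Fin m → Set
    Split y = y ≡ a ⊎ ∃ λ c → OtherNbr a b c ≡ true × Side c a y ≡ true
    extend : ∀ y z → Split y → W a b y z ≡ true → Split z
    extend y z (inj₁ refl) e = inj₂ (z , ∧-intro (W⇒adj e) (cong not (BoolP.¬-not z≢b)) , side-self z a)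
      where
      z≢b : ⌊ z ≟ b ⌋ ≢ true
      z≢b z≟b with ≟-sound {x = z} z≟b
      ... | refl = true≢false e (W-removed y z)
    extend y z (inj₂ (c , nb , sy)) e with edge-or-kept c a (W⇒adj e)
    ... | inj₁ (_ , refl)        = inj₁ refl
    ... | inj₂ (inj₁ (_ , refl)) = inj₂ (c , nb , side-self c a)
    ... | inj₂ (inj₂ w)          = inj₂ (c , nb , side-closed sy w)

heavy-part : ∀ {k x y N} → 3 * k ≤ N → N ≤ x + y → y < k → 2 * k < x
heavy-part {k} {x} {y} {N} 3k≤N N≤x+y y<k = ℕP.+-cancelʳ-≤ y (suc (2 * k)) x (begin
  suc (2 * k) + y  ≡⟨ sym (ℕP.+-suc (2 * k) y) ⟩
  2 * k + suc y    ≤⟨ ℕP.+-monoʳ-≤ (2 * k) y<k ⟩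
  2 * k + k        ≡⟨ ℕP.+-comm (2 * k) k ⟩
  3 * k            ≤⟨ 3k≤N ⟩
  N                ≤⟨ N≤x+y ⟩
  x + y            ∎)
  where open ℕP.≤-Reasoning

one-third : ∀ {k x y N} → 3 * k ≤ N → N ≤ x + y → k ≤ x ⊎ k ≤ y
one-third {k} {x} {y} 3k≤N N≤x+y with k ℕP.≤? y
... | yes k≤y = inj₂ k≤y
... | no  k≰y = inj₁ (ℕP.≤-trans (ℕP.m≤m+n k (k + 0)) (ℕP.<⇒≤ (heavy-part 3k≤N N≤x+y (ℕP.≰⇒> k≰y))))

module Decomposition {n : ℕ} {G : Graph n} (D : BranchDecomposition G) where

  open EdgeSides (T D) (proj₂ (tree D))

  leafOf : Fin n → Leaf (T D)
  leafOf x = proj₁ (Bijection.surjective (δ D) x)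

  to-leafOf : ∀ x → Bijection.to (δ D) (leafOf x) ≡ x
  to-leafOf x = proj₂ (Bijection.surjective (δ D) x) refl

  leaf : Fin n → Fin (m D)
  leaf x = proj₁ (leafOf x)

  leaf-injective : ∀ {x y} → leaf x ≡ leaf y → x ≡ y
  leaf-injective {x} {y} eq = begin
    x                              ≡⟨ sym (to-leafOf x) ⟩
    Bijection.to (δ D) (leafOf x)  ≡⟨ cong (Bijection.to (δ D)) (same-leaf (leafOf x) (leafOf y) eq) ⟩
    Bijection.to (δ D) (leafOf y)  ≡⟨ to-leafOf y ⟩
    y                              ∎
    where
    open ≡-Reasoning
    same-leaf : (ℓ ℓ′ : Leaf (T D)) → proj₁ ℓ ≡ proj₁ ℓ′ → ℓ ≡ ℓ′
    same-leaf (t , d) (.t , d′) refl = cong (t ,_) (ℕP.≡-irrelevant d d′)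

  degree-≤3 : ∀ v → count (adj (T D) v) ≤ 3
  degree-≤3 v = subst (_≤ 3) (sym (count-tabulate (adj (T D) v))) (maxdeg D v)

  leaf-degree : ∀ x → count (adj (T D) (leaf x)) ≡ 1
  leaf-degree x = trans (count-tabulate (adj (T D) (leaf x))) (proj₂ (leafOf x))

  -- T has an edge: the leaf carrying some vertex of G has a neighbour.
  some-edge : 2 ≤ n → ∃₂ λ a b → adj (T D) a b ≡ true
  some-edge (s≤s (s≤s _)) =
    leaf zero , count-witness _ (ℕP.≤-reflexive (sym (leaf-degree zero)))

  weight : (Fin n → Bool) → Fin (m D) → Fin (m D) → ℕ
  weight P a b = count (λ x → P x ∧ Side a b (leaf x))

  weight-cover : ∀ P a b → count P ≤ weight P a b + weight P b a
  weight-cover P a b = count-∪ P _ _ on-a-side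
    where
    on-a-side : ∀ x → P x ≡ true → (P x ∧ Side a b (leaf x)) ≡ true ⊎ (P x ∧ Side b a (leaf x)) ≡ true
    on-a-side x Px with sides-cover (proj₁ (tree D)) a b (leaf x)
    ... | inj₁ s = inj₁ (∧-intro Px s)
    ... | inj₂ s = inj₂ (∧-intro Px s)

  side⇒cutSide : ∀ {a b x} → Side a b (leaf x) ≡ true → CutSide D a b x
  side⇒cutSide {x = x} s = leafOf x , to-leafOf x , side-sound s

  far-side⇒¬cutSide : ∀ {a b y} → adj (T D) a b ≡ true → Side b a (leaf y) ≡ true → ¬ CutSide D a b y
  far-side⇒¬cutSide {a} {b} {y} ab s (ℓ , ℓ↦y , ρ) =
    sides-disjoint ab (subst (λ t → Side a b (proj₁ t) ≡ true) ℓ≡ (side-complete ρ)) s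
    where
    ℓ≡ : ℓ ≡ leafOf y
    ℓ≡ = Bijection.injective (δ D) (trans ℓ↦y (sym (to-leafOf y)))

  leafAt : Fin (m D) → Fin n → Bool
  leafAt a x = ⌊ leaf x ≟ a ⌋

  leafAt-≤1 : ∀ a → count (leafAt a) ≤ 1
  leafAt-≤1 a = count-≤1 (leafAt a) (λ x y lx ly → leaf-injective (trans (≟-sound lx) (sym (≟-sound ly))))

  weight-split : ∀ P {a b} k → (∀ c → OtherNbr a b c ≡ true → weight P c a ≤ k) →
                 weight P a b ≤ count (leafAt a) + count (OtherNbr a b) * k
  weight-split P {a} {b} k light =
    ℕP.≤-trans (count-∪ onSide (leafAt a) rest at-a-or-rest)
               (ℕP.+-monoʳ-≤ (count (leafAt a))
                 (count-⋃ (OtherNbr a b) (λ c x → P x ∧ Side c a (leaf x)) rest k light below))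
    where
    onSide rest : Fin n → Bool
    onSide x = P x ∧ Side a b (leaf x)
    rest x = onSide x ∧ not (leafAt a x)
    at-a-or-rest : ∀ x → onSide x ≡ true → leafAt a x ≡ true ⊎ rest x ≡ true
    at-a-or-rest x sx with leafAt a x
    ... | true  = inj₁ refl
    ... | false = inj₂ (∧-intro sx refl)
    below : ∀ x → rest x ≡ true → ∃ λ c → OtherNbr a b c ≡ true × (P x ∧ Side c a (leaf x)) ≡ true
    below x rx with side-split (∧-right {P x} (∧-left {onSide x} rx))
    ... | inj₁ at-a = ⊥-elim (true≢false (subst (λ t → ⌊ t ≟ a ⌋ ≡ true) (sym at-a) (≟-refl a))
                                         (BoolP.not-injective (∧-right rx)))
    ... | inj₂ (c , nb , s) = c , nb , ∧-intro (∧-left {P x} (∧-left {onSide x} rx)) s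

  -- b itself is a neighbour of a that is not counted among the others.
  others<degree : ∀ {a b} → adj (T D) a b ≡ true → count (OtherNbr a b) < count (adj (T D) a)
  others<degree {b = b} ab = count-< (λ _ → otherNbr-adj) b ab (BoolP.¬-not (λ nb → otherNbr-≢ nb refl))

  -- Since a has degree at most 3, it has at most two other neighbours, and
  -- none if it is a leaf; so the bound of weight-split is at most 2k.
  degree-budget : ∀ {a b} k → 1 ≤ k → adj (T D) a b ≡ true →
                  count (leafAt a) + count (OtherNbr a b) * k ≤ 2 * k
  degree-budget {a} {b} k 1≤k ab with count (OtherNbr a b) | others<degree ab
  ... | zero  | _ = begin
    count (leafAt a) + 0  ≡⟨ ℕP.+-identityʳ _ ⟩
    count (leafAt a)      ≤⟨ leafAt-≤1 a ⟩
    1                     ≤⟨ 1≤k ⟩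
    k                     ≤⟨ ℕP.m≤m+n k (k + 0) ⟩
    2 * k                 ∎
    where open ℕP.≤-Reasoning
  ... | suc j | two≤deg = begin
    count (leafAt a) + suc j * k  ≡⟨ cong (_+ suc j * k) (count-none (leafAt a) no-leaf) ⟩
    suc j * k                     ≤⟨ ℕP.*-monoˡ-≤ k (ℕP.≤-pred (ℕP.≤-trans two≤deg (degree-≤3 a))) ⟩
    2 * k                         ∎
    where
    open ℕP.≤-Reasoning
    no-leaf : ∀ x → leafAt a x ≢ true
    no-leaf x l with ≟-sound {x = leaf x} l
    ... | refl = 2≰1 (subst (suc (suc j) ≤_) (leaf-degree x) two≤deg)
      where
      2≰1 : ∀ {i} → suc (suc i) ≤ 1 → ⊥
      2≰1 (s≤s ())

  weight-budget : ∀ P {a b} k → 1 ≤ k → adj (T D) a b ≡ true →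
                  (∀ c → OtherNbr a b c ≡ true → weight P c a ≤ k) → weight P a b ≤ 2 * k
  weight-budget P k 1≤k ab light = ℕP.≤-trans (weight-split P k light) (degree-budget k 1≤k ab)

  Balanced : (Fin n → Bool) → ℕ → Fin (m D) → Fin (m D) → Set
  Balanced P k a b = adj (T D) a b ≡ true × k ≤ weight P a b × k ≤ weight P b a

  -- Starting from an edge ab heavy at a, move into the heavy side until the
  -- edge becomes balanced.  If ab is light at b, it is heavier than 2k at
  -- a, so by weight-budget some other neighbour c carries more than k and
  -- we continue with ca, whose side is strictly smaller (side-shrinks).
  module Search (P : Fin n → Bool) (k : ℕ) (1≤k : 1 ≤ k) (3k≤P : 3 * k ≤ count P) where

    descend : ∀ size a b → count (Side a b) ≤ size → adj (T D) a b ≡ true →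
              k ≤ weight P a b → ∃₂ (Balanced P k)
    descend zero a b small ab heavy =
      ⊥-elim (ℕP.n≮0 (ℕP.<-≤-trans (count-pos (Side a b) a (side-self a b)) small))
    descend (suc size) a b small ab heavy with k ℕP.≤? weight P b a
    ... | yes k≤ba = a , b , ab , heavy , k≤ba
    ... | no  k≰ba with FinP.any? (λ c → (OtherNbr a b c BoolP.≟ true) ×-dec (suc k ℕP.≤? weight P c a))
    ...   | yes (c , nb , c-heavy) =
      descend size c a (ℕP.≤-pred (ℕP.<-≤-trans (side-shrinks ab nb) small))
              (trans (Graph.sym (T D) c a) (otherNbr-adj nb)) (ℕP.<⇒≤ c-heavy)
    ...   | no  all-light = ⊥-elim (ℕP.<⇒≱ (heavy-part 3k≤P (weight-cover P a b) (ℕP.≰⇒> k≰ba))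
                                          (weight-budget P k 1≤k ab light))
      where
      light : ∀ c → OtherNbr a b c ≡ true → weight P c a ≤ k
      light c nb = ℕP.≮⇒≥ (λ c-heavy → all-light (c , nb , c-heavy))

  balanced-edge : 2 ≤ n → ∀ P k → 3 * k ≤ count P → ∃₂ (Balanced P k)
  balanced-edge two P k 3k≤P with some-edge two
  balanced-edge two P zero    3k≤P | a , b , ab = a , b , ab , z≤n , z≤n
  balanced-edge two P (suc k) 3k≤P | a , b , ab with one-third 3k≤P (weight-cover P a b)
  ... | inj₁ heavy-a = descend (m D) a b (count-≤ _) ab heavy-a
    where open Search P (suc k) (s≤s z≤n) 3k≤P
  ... | inj₂ heavy-b = descend (m D) b a (count-≤ _) (trans (Graph.sym (T D) b a) ab) heavy-b
    where open Search P (suc k) (s≤s z≤n) 3k≤P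

  GoodCut : Subset n → Subset n → ℕ → ℕ → Set
  GoodCut A B kA kB =
    Σ[ a ∈ Fin (m D) ] Σ[ b ∈ Fin (m D) ] (adj (T D) a b ≡ true
      × AtLeast kA (λ x → CutSide D a b x × x ∈ A)
      × AtLeast kB (λ y → ¬ CutSide D a b y × y ∈ B))

  good-cut : ∀ {a b} (A B : Subset n) {kA kB} → adj (T D) a b ≡ true →
             kA ≤ weight (lookup A) a b → kB ≤ weight (lookup B) b a → GoodCut A B kA kB
  good-cut {a} {b} A B ab kA≤ kB≤ = a , b , ab ,
    atLeast-count _ _ _ (λ x q → side⇒cutSide (∧-right q) , lookup⇒[]= x A (∧-left q)) kA≤ ,
    atLeast-count _ _ _ (λ y q → far-side⇒¬cutSide ab (∧-right q) , lookup⇒[]= y B (∧-left q)) kB≤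

third-of : ∀ {n} (A : Subset n) → 3 * (∣ A ∣ / 3) ≤ count (lookup A)
third-of A = subst₂ _≤_ (ℕP.*-comm (∣ A ∣ / 3) 3) (sym (count-lookup A)) (m/n*n≤m ∣ A ∣ 3)

-- Take an edge ab balanced for A; orient it so that its side away from a
-- heavy part of B forms Y.
lemma3 : ∀ {n : ℕ} → 2 ≤ n → (G : Graph n) → (A B : Subset n) →
    (D : BranchDecomposition G) →
    Σ[ a ∈ Fin (m D) ] Σ[ b ∈ Fin (m D) ] (adj (T D) a b ≡ true
      × AtLeast (∣ A ∣ / 3) (λ x → CutSide D a b x × x ∈ A)
      × AtLeast (∣ B ∣ / 3) (λ y → ¬ CutSide D a b y × y ∈ B))
lemma3 two G A B D = orient (balanced-edge two (lookup A) (∣ A ∣ / 3) (third-of A))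
  where
  open Decomposition D
  orient : ∃₂ (Balanced (lookup A) (∣ A ∣ / 3)) → GoodCut A B (∣ A ∣ / 3) (∣ B ∣ / 3)
  orient (a , b , ab , A-at-a , A-at-b) with one-third (third-of B) (weight-cover (lookup B) a b)
  ... | inj₂ B-at-b = good-cut A B ab A-at-a B-at-b
  ... | inj₁ B-at-a = good-cut A B ba A-at-b B-at-a
    where
    ba : adj (T D) b a ≡ true
    ba = trans (Graph.sym (T D) b a) ab
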